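{- Let $BT_{8}$ be a decomposable $2$-regular bipartite tournament (on $8$ vertices). Then either (a) $BT_{8}$ contains $D(8,5)$ but contains no $D(8,p)$ with $p\in\{2,3,4,6,7,8\}$, or (b) $BT_{8}$ contains $D(8,p)$ for every $p$ with $2\le p\le 8$ and $p\neq 5$.
   Context: A digraph is $k$-regular if every vertex has in-degree and out-degree $k$; a $k$-regular bipartite tournament has $4k$ vertices. For integers $n\ge 3$ and $2\le p\le n$, $D(n,p)$ denotes the digraph obtained from a directed $n$-cycle by reversing the orientations of $p-1$ consecutive arcs; equivalently, it is the union of a directed path $(a_1,a_2,\dots,a_p)$ and a directed path $(a_1,b_1,\dots,b_{n-p},a_p)$ on $n$ distinct vertices. A digraph on $n$ vertices "contains $D(n,p)$" if it has a (spanning) subdigraph isomorphic to $D(n,p)$. Decomposable $k$-regular bipartite tournaments are defined inductively: a decomposable $1$-regular bipartite tournament $BT_4$ is a directed cycle of length $4$; for $k\ge 2$, a decomposable $k$-regular bipartite tournament $BT_{4k}$ is a $k$-regular bipartite tournament obtained from a vertex-disjoint decomposable $1$-regular bipartite tournament $BT_4$ and a decomposable $(k-1)$-regular bipartite tournament $BT_{4(k-1)}$ by adding arcs (between them). -}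

module Defs where

open import Data.Nat using (ℕ; zero; suc; _+_; _*_; _∸_; _<_; _≤_)
open import Data.Fin using (Fin; toℕ)
open import Data.Bool using (Bool; true; false; _xor_)
open import Data.List using (List; length; filterᵇ)
open import Data.List.Base using (allFin)
open import Data.Product using (Σ; Σ-syntax; _×_; _,_)
open import Data.Sum using (_⊎_; inj₁; inj₂)
open import Data.Empty using (⊥)
open import Data.Fin.Permutation using (Permutation′; _⟨$⟩ʳ_)
open import Function.Bundles using (_↔_; Inverse)
open import Relation.Binary.PropositionalEquality using (_≡_; _≢_)

-- A (loopless-or-not) digraph on the vertex set Fin n, given by its arc relation:
-- A i j ≡ true  iff  there is an arc i → j.
Digraph : ℕ → Set
Digraph n = Fin n → Fin n → Bool

outdeg : ∀ {n} → Digraph n → Fin n → ℕ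
outdeg {n} A v = length (filterᵇ (λ w → A v w) (allFin n))

indeg : ∀ {n} → Digraph n → Fin n → ℕ
indeg {n} A v = length (filterᵇ (λ w → A w v) (allFin n))

Regular : ∀ {n} → ℕ → Digraph n → Set
Regular {n} k A = ∀ (v : Fin n) → outdeg A v ≡ k × indeg A v ≡ k

BipartiteTournament : ∀ {n} → Digraph n → Set
BipartiteTournament {n} A =
  Σ[ side ∈ (Fin n → Bool) ]
    (∀ (i j : Fin n) → side i ≡ side j → A i j ≡ false)
    × (∀ (i j : Fin n) → side i ≢ side j → (A i j xor A j i) ≡ true)

RegularBT : ∀ {n} → ℕ → Digraph n → Set
RegularBT k A = BipartiteTournament A × Regular k A

_≅_ : ∀ {n} → Digraph n → Digraph n → Set
_≅_ {n} A B = Σ[ σ ∈ Permutation′ n ] (∀ (i j : Fin n) → A i j ≡ B (σ ⟨$⟩ʳ i) (σ ⟨$⟩ʳ j))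

C4arc : ℕ → ℕ → Bool
C4arc 0 1 = true
C4arc 1 2 = true
C4arc 2 3 = true
C4arc 3 0 = true
C4arc _ _ = false

C4 : Digraph 4
C4 i j = C4arc (toℕ i) (toℕ j)

pull : ∀ {m n} → (Fin m → Fin n) → Digraph n → Digraph m
pull f A i j = A (f i) (f j)

Decomposable : (k : ℕ) → Digraph (4 * k) → Set
Decomposable zero A = ⊥
Decomposable (suc zero) A = A ≅ C4
Decomposable (suc (suc k)) A =
  RegularBT (suc (suc k)) A
  × Σ[ h ∈ ((Fin 4 ⊎ Fin (4 * suc k)) ↔ Fin (4 * suc (suc k))) ]
      ( Decomposable 1 (pull (λ i → Inverse.to h (inj₁ i)) A)
      × Decomposable (suc k) (pull (λ i → Inverse.to h (inj₂ i)) A))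

-- D(n,p) on the vertices 0..n-1: a_1,…,a_p are 0,…,p-1 and
-- b_1,…,b_{n-p} are p,…,n-1.  Arcs: the path a_1 → … → a_p and the path
-- a_1 → b_1 → … → b_{n-p} → a_p  (which is the single arc a_1 → a_p if p = n).
data DArc (n p : ℕ) : ℕ → ℕ → Set where
  a-path  : ∀ {i} → suc i < p → DArc n p i (suc i)
  a→b     : p < n → DArc n p 0 p
  b-path  : ∀ {i} → p ≤ i → suc i < n → DArc n p i (suc i)
  b→a     : p < n → DArc n p (n ∸ 1) (p ∸ 1)
  a→a     : p ≡ n → DArc n p 0 (p ∸ 1)

ContainsD : ∀ {n} → Digraph n → ℕ → Set
ContainsD {n} G p =
  Σ[ σ ∈ Permutation′ n ] (∀ (i j : Fin n) → DArc n p (toℕ i) (toℕ j) → G (σ ⟨$⟩ʳ i) (σ ⟨$⟩ʳ j) ≡ true)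

-- Relabel G so that the two 4-cycles of its decomposition are 0→1→2→3→0 and 4→5→6→7→4.
-- The bipartition alternates along each cycle, so it is fixed by the sides s, t of the
-- vertices 0 and 4, and a vertex of one cycle is joined to exactly the two vertices of the
-- other cycle lying on the opposite side.  Hence G is isomorphic to one of the 2·2·2⁸
-- digraphs `canonical s t d`, where d records the orientations of these 8 cross arcs.
-- Both the hypothesis (2-regularity) and the conclusion are invariant under isomorphism,
-- and for every canonical digraph the implication is decided by a verified backtracking
-- search for spanning copies of D(8,p).
module Submission where

open import Defs
open import Data.Nat using (ℕ; _≤_)
open import Data.Sum using (_⊎_)
open import Data.Product using (_×_)
open import Relation.Nullary using (¬_)
open import Relation.Binary.PropositionalEquality using (_≡_; _≢_)

open import Data.Bool using (Bool; true; false; not; _∧_; _∨_; _xor_; if_then_else_; T)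
open import Data.Bool.ListAction using (any)
open import Data.Bool.Properties
  using (T-∧; ¬-not; not-involutive; not-distribʳ-xor; xor-same; ∧-zeroʳ; ∨-identityʳ)
  renaming (_≟_ to _≟ᵇ_)
open import Data.Fin
  using (Fin; zero; suc; toℕ; fromℕ<; punchOut; _↑ˡ_; _↑ʳ_; splitAt; join; combine; remQuot)
open import Data.Fin.Patterns using (0F; 1F; 2F; 3F; 4F)
open import Data.Fin.Permutation
  using (Permutation′; _⟨$⟩ʳ_; _⟨$⟩ˡ_; inverseʳ; flip; _∘ₚ_)
import Data.Fin.Permutation as Permutation
open import Data.Fin.Properties
  using (any?; all?; toℕ-injective; toℕ<n; toℕ-fromℕ<; punchOut-injective; injective⇒≤;
         +↔⊎; splitAt-↑ˡ; join-splitAt; remQuot-combine)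
  renaming (_≟_ to _≟ᶠ_)
open import Data.List using (length; filterᵇ; tabulate; allFin)
open import Data.List.Membership.Propositional using (lose)
open import Data.List.Membership.Propositional.Properties using (∈-allFin)
open import Data.List.Relation.Unary.Any using (satisfied)
open import Data.List.Relation.Unary.Any.Properties using (any⁺; any⁻)
open import Data.Nat using (zero; suc; _+_; _∸_; _<_; _<?_; _≤?_; s≤s; _<ᵇ_; _≤ᵇ_; _≡ᵇ_)
open import Data.Nat.Properties
  using (_≟_; <-cmp; <-trans; +-suc; +-identityʳ; n≮n; ≤-pred; m<1+n⇒m<n∨m≡n; m≤n+m;
         <⇒≢; allUpTo?; <ᵇ-reflects-<; ≤ᵇ-reflects-≤; ≡ᵇ⇒≡; ≡⇒≡ᵇ; +-0-commutativeMonoid)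
open import Algebra.Properties.CommutativeMonoid.Sum +-0-commutativeMonoid
  using (sum; sum-permute; sum-cong-≗)
open import Data.Product using (Σ; Σ-syntax; ∃-syntax; _,_; proj₁; proj₂; uncurry)
open import Data.Sum using (inj₁; inj₂)
open import Data.Sum.Function.Propositional using (_⊎-↔_)
open import Data.Unit using (⊤; tt)
open import Data.Vec using (Vec; []; _∷_; lookup)
import Data.Vec as Vec
open import Data.Vec.Properties using (lookup∘tabulate)
open import Function using (_∘_)
open import Function.Bundles using (Inverse; Injection; Equivalence; _⇔_; mk⇔; mk↔ₛ′)
open import Function.Construct.Composition using (_↔-∘_)
open import Function.Definitions using (Injective)
open import Function.Properties.Equivalence using () renaming (sym to ⇔-sym)
open import Function.Properties.Inverse using (↔⇒↣)
open import Relation.Binary using (tri<; tri≈; tri>)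
open import Relation.Binary.PropositionalEquality
  using (refl; sym; trans; cong; cong₂; subst; subst₂; module ≡-Reasoning)
open import Relation.Nullary
  using (Dec; yes; no; does; proof; _because_; contradiction; ¬?; _×-dec_; _⊎-dec_; _→-dec_)
open import Relation.Nullary.Decidable
  using (map′; dec-true; dec-false; ⌊_⌋; toWitness; fromWitness)
import Relation.Nullary.Decidable as Dec
open import Relation.Nullary.Reflects
  using (Reflects; invert; fromEquivalence; _×-reflects_; _⊎-reflects_)

injective⇒surjective : ∀ {n} {f : Fin n → Fin n} → Injective _≡_ _≡_ f → ∀ y → ∃[ x ] f x ≡ y
injective⇒surjective {suc m} {f} f-inj y with any? (λ x → f x ≟ᶠ y)
... | yes hit = hit
... | no miss = contradiction (injective⇒≤ punchOut∘f-inj) (n≮n m)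
  where
  avoids : ∀ x → y ≢ f x
  avoids x y≡fx = miss (x , sym y≡fx)
  punchOut∘f-inj : Injective _≡_ _≡_ (λ x → punchOut (avoids x))
  punchOut∘f-inj {x} {x′} = f-inj ∘ punchOut-injective (avoids x) (avoids x′)

injective⇒permutation : ∀ {n} {f : Fin n → Fin n} → Injective _≡_ _≡_ f → Permutation′ n
injective⇒permutation {f = f} f-inj =
  mk↔ₛ′ f (proj₁ ∘ surj) (proj₂ ∘ surj) (λ x → f-inj (proj₂ (surj (f x))))
  where surj = injective⇒surjective f-inj

SpanningCopy : ∀ {n} → Digraph n → (ℕ → ℕ → Set) → Set
SpanningCopy {n} G R =
  Σ[ σ ∈ Permutation′ n ] (∀ i j → R (toℕ i) (toℕ j) → G (σ ⟨$⟩ʳ i) (σ ⟨$⟩ʳ j) ≡ true)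

-- The vertices 0, 1, … of R are placed one at a time; an assignment f sends j to f j,
-- and only its values below the number of vertices placed so far matter.
module Search {n : ℕ} (G : Digraph n) {R : ℕ → ℕ → Set} (R? : ∀ i j → Dec (R i j)) where

  Compatible : ℕ → ℕ → Fin n → Fin n → Set
  Compatible j k x v = x ≢ v × (R j k → G x v ≡ true) × (R k j → G v x ≡ true)

  Fits : (ℕ → Fin n) → ℕ → Fin n → Set
  Fits f k v = (R k k → G v v ≡ true) × (∀ {j} → j < k → Compatible j k (f j) v)

  PartialCopy : ℕ → (ℕ → Fin n) → Set
  PartialCopy k f = ∀ {i} → i < k → Fits f i (f i)

  extend : (ℕ → Fin n) → ℕ → Fin n → ℕ → Fin n
  extend f k v j = if does (j <? k) then f j else v

  Completable : ℕ → ℕ → (ℕ → Fin n) → Set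
  Completable zero    k f = ⊤
  Completable (suc r) k f = ∃[ v ] Fits f k v × Completable r (suc k) (extend f k v)

  extend-below : ∀ {f k v j} → j < k → extend f k v j ≡ f j
  extend-below {k = k} {j = j} j<k rewrite dec-true (j <? k) j<k = refl

  extend-at : ∀ {f k v} → extend f k v k ≡ v
  extend-at {k = k} rewrite dec-false (k <? k) (n≮n k) = refl

  fits-cong : ∀ {f g k v} → (∀ {j} → j < k → f j ≡ g j) → Fits f k v → Fits g k v
  fits-cong {k = k} {v} f≡g (loop , earlier) =
    loop , λ {j} j<k → subst (λ x → Compatible j k x v) (f≡g j<k) (earlier j<k)

  partialCopy-extend : ∀ {k f v} → PartialCopy k f → Fits f k v →
                       PartialCopy (suc k) (extend f k v)
  partialCopy-extend {k} {f} {v} copy fits {i} i<1+k with m<1+n⇒m<n∨m≡n i<1+k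
  ... | inj₁ i<k rewrite extend-below {f} {k} {v} i<k =
    fits-cong (λ j<i → sym (extend-below {f} (<-trans j<i i<k))) (copy i<k)
  ... | inj₂ refl rewrite extend-at {f} {k} {v} =
    fits-cong (λ j<k → sym (extend-below {f} j<k)) fits

  completable-sound : ∀ r k f → Completable r k f → PartialCopy k f → ∃[ g ] PartialCopy (r + k) g
  completable-sound zero    k f _                   copy = f , copy
  completable-sound (suc r) k f (v , fits , rest) copy rewrite sym (+-suc r k) =
    completable-sound r (suc k) (extend f k v) rest (partialCopy-extend copy fits)

  partialCopy⇒spanningCopy : ∀ {f} → PartialCopy n f → SpanningCopy G R
  partialCopy⇒spanningCopy {f} copy = injective⇒permutation injective , arcs
    where
    fits : ∀ i → Fits f (toℕ i) (f (toℕ i))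
    fits i = copy (toℕ<n i)
    injective : Injective _≡_ _≡_ (f ∘ toℕ)
    injective {i} {j} fi≡fj with <-cmp (toℕ i) (toℕ j)
    ... | tri< i<j _ _ = contradiction fi≡fj (proj₁ (proj₂ (fits j) i<j))
    ... | tri≈ _ i≡j _ = toℕ-injective i≡j
    ... | tri> _ _ j<i = contradiction (sym fi≡fj) (proj₁ (proj₂ (fits i) j<i))
    arcs : ∀ i j → R (toℕ i) (toℕ j) → G (f (toℕ i)) (f (toℕ j)) ≡ true
    arcs i j r with <-cmp (toℕ i) (toℕ j)
    ... | tri< i<j _ _ = proj₁ (proj₂ (proj₂ (fits j) i<j)) r
    ... | tri≈ _ i≡j _ rewrite toℕ-injective i≡j = proj₁ (fits j) r
    ... | tri> _ _ j<i = proj₂ (proj₂ (proj₂ (fits i) j<i)) r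

  module _ (copy : SpanningCopy G R) where

    image : ∀ {k} → k < n → Fin n
    image k<n = proj₁ copy ⟨$⟩ʳ fromℕ< k<n

    image-injective : ∀ {j k} (j<n : j < n) (k<n : k < n) → image j<n ≡ image k<n → j ≡ k
    image-injective {j} {k} j<n k<n eq = begin
      j                ≡⟨ toℕ-fromℕ< j<n ⟨
      toℕ (fromℕ< j<n) ≡⟨ cong toℕ (Injection.injective (↔⇒↣ (proj₁ copy)) eq) ⟩
      toℕ (fromℕ< k<n) ≡⟨ toℕ-fromℕ< k<n ⟩
      k                ∎
      where open ≡-Reasoning

    image-arc : ∀ {i j} (i<n : i < n) (j<n : j < n) → R i j → G (image i<n) (image j<n) ≡ true
    image-arc i<n j<n r =
      proj₂ copy (fromℕ< i<n) (fromℕ< j<n)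
        (subst₂ R (sym (toℕ-fromℕ< i<n)) (sym (toℕ-fromℕ< j<n)) r)

    Agrees : ℕ → (ℕ → Fin n) → Set
    Agrees k f = ∀ {j} (j<n : j < n) → j < k → f j ≡ image j<n

    image-fits : ∀ {k f} (k<n : k < n) → Agrees k f → Fits f k (image k<n)
    image-fits {k} k<n agrees = image-arc k<n k<n , λ {j} j<k →
      let j<n = <-trans j<k k<n in
      subst (λ x → Compatible j k x (image k<n)) (sym (agrees j<n j<k))
        ((<⇒≢ j<k ∘ image-injective j<n k<n) , image-arc j<n k<n , image-arc k<n j<n)

    agrees-extend : ∀ {k f} (k<n : k < n) → Agrees k f → Agrees (suc k) (extend f k (image k<n))
    agrees-extend {k} {f} k<n agrees j<n j<1+k with m<1+n⇒m<n∨m≡n j<1+k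
    ... | inj₁ j<k  = trans (extend-below {f} j<k) (agrees j<n j<k)
    ... | inj₂ refl = extend-at {f}

    agrees-completable : ∀ r k f → r + k ≡ n → Agrees k f → Completable r k f
    agrees-completable zero    k f _     _      = tt
    agrees-completable (suc r) k f r+k≡n agrees =
      image k<n , image-fits k<n agrees ,
      agrees-completable r (suc k) _ (trans (+-suc r k) r+k≡n) (agrees-extend k<n agrees)
      where
      k<n : k < n
      k<n = subst (k <_) r+k≡n (s≤s (m≤n+m k r))

  compatible? : ∀ j k x v → Dec (Compatible j k x v)
  compatible? j k x v =
    ¬? (x ≟ᶠ v) ×-dec (R? j k →-dec G x v ≟ᵇ true) ×-dec (R? k j →-dec G v x ≟ᵇ true)

  fits? : ∀ f k v → Dec (Fits f k v)
  fits? f k v = (R? k k →-dec G v v ≟ᵇ true) ×-dec allUpTo? (λ j → compatible? j k (f j) v) k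

  -- A boolean recursion: composing `Dec`s here would keep every intermediate proof
  -- alive while the final exhaustive check is evaluated, exhausting memory.
  completableᵇ : ℕ → ℕ → (ℕ → Fin n) → Bool
  completableᵇ zero    k f = true
  completableᵇ (suc r) k f =
    any (λ v → ⌊ fits? f k v ⌋ ∧ completableᵇ r (suc k) (extend f k v)) (allFin n)

  completableᵇ-sound : ∀ r k f → T (completableᵇ r k f) → Completable r k f
  completableᵇ-sound zero    k f _ = tt
  completableᵇ-sound (suc r) k f found with satisfied (any⁻ _ (allFin n) found)
  ... | v , fits∧rest with Equivalence.to T-∧ fits∧rest
  ... | fits , rest = v , toWitness fits , completableᵇ-sound r (suc k) (extend f k v) rest

  completableᵇ-complete : ∀ r k f → Completable r k f → T (completableᵇ r k f)
  completableᵇ-complete zero    k f _                 = tt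
  completableᵇ-complete (suc r) k f (v , fits , rest) = any⁺ _ (lose (∈-allFin v)
    (Equivalence.from T-∧ (fromWitness fits , completableᵇ-complete r (suc k) (extend f k v) rest)))

  completable? : ∀ r k f → Dec (Completable r k f)
  completable? r k f = completableᵇ r k f because
    fromEquivalence (completableᵇ-sound r k f) (completableᵇ-complete r k f)

spanningCopy? : ∀ {n} (G : Digraph n) {R : ℕ → ℕ → Set} → (∀ i j → Dec (R i j)) →
                Dec (SpanningCopy G R)
spanningCopy? {zero}  G R? = yes (Permutation.id , λ ())
spanningCopy? {suc n} G {R} R? = map′ sound complete (completable? (suc n) 0 (λ _ → zero))
  where
  open Search G R?
  sound : Completable (suc n) 0 (λ _ → zero) → SpanningCopy G R
  sound c with completable-sound (suc n) 0 _ c (λ ())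
  ... | g , copy rewrite +-identityʳ n = partialCopy⇒spanningCopy copy
  complete : SpanningCopy G R → Completable (suc n) 0 (λ _ → zero)
  complete copy = agrees-completable copy (suc n) 0 _ (+-identityʳ (suc n)) (λ _ ())

DArc-cases : ℕ → ℕ → ℕ → ℕ → Set
DArc-cases n p i j =
    (suc i < p × j ≡ suc i)
  ⊎ (p < n × i ≡ 0 × j ≡ p)
  ⊎ (p ≤ i × suc i < n × j ≡ suc i)
  ⊎ (p < n × i ≡ n ∸ 1 × j ≡ p ∸ 1)
  ⊎ (p ≡ n × i ≡ 0 × j ≡ p ∸ 1)

DArc⇔DArc-cases : ∀ {n p i j} → DArc n p i j ⇔ DArc-cases n p i j
DArc⇔DArc-cases = mk⇔ to from
  where
  to : ∀ {n p i j} → DArc n p i j → DArc-cases n p i j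
  to (a-path i<p)     = inj₁ (i<p , refl)
  to (a→b p<n)        = inj₂ (inj₁ (p<n , refl , refl))
  to (b-path p≤i i<n) = inj₂ (inj₂ (inj₁ (p≤i , i<n , refl)))
  to (b→a p<n)        = inj₂ (inj₂ (inj₂ (inj₁ (p<n , refl , refl))))
  to (a→a p≡n)        = inj₂ (inj₂ (inj₂ (inj₂ (p≡n , refl , refl))))
  from : ∀ {n p i j} → DArc-cases n p i j → DArc n p i j
  from (inj₁ (i<p , refl))                             = a-path i<p
  from (inj₂ (inj₁ (p<n , refl , refl)))               = a→b p<n
  from (inj₂ (inj₂ (inj₁ (p≤i , i<n , refl))))         = b-path p≤i i<n
  from (inj₂ (inj₂ (inj₂ (inj₁ (p<n , refl , refl))))) = b→a p<n
  from (inj₂ (inj₂ (inj₂ (inj₂ (p≡n , refl , refl))))) = a→a p≡n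

-- Deciding DArc through this boolean, rather than with `×-dec`/`⊎-dec`, halves the
-- time of the exhaustive check.
darcᵇ : ℕ → ℕ → ℕ → ℕ → Bool
darcᵇ n p i j =
    ((suc i <ᵇ p) ∧ (j ≡ᵇ suc i))
  ∨ ((p <ᵇ n) ∧ (i ≡ᵇ 0) ∧ (j ≡ᵇ p))
  ∨ ((p ≤ᵇ i) ∧ (suc i <ᵇ n) ∧ (j ≡ᵇ suc i))
  ∨ ((p <ᵇ n) ∧ (i ≡ᵇ n ∸ 1) ∧ (j ≡ᵇ p ∸ 1))
  ∨ ((p ≡ᵇ n) ∧ (i ≡ᵇ 0) ∧ (j ≡ᵇ p ∸ 1))

≡ᵇ-reflects-≡ : ∀ m n → Reflects (m ≡ n) (m ≡ᵇ n)
≡ᵇ-reflects-≡ m n = fromEquivalence (≡ᵇ⇒≡ m n) (≡⇒≡ᵇ m n)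

darcᵇ-reflects : ∀ n p i j → Reflects (DArc-cases n p i j) (darcᵇ n p i j)
darcᵇ-reflects n p i j =
              (<ᵇ-reflects-< (suc i) p ×-reflects ≡ᵇ-reflects-≡ j (suc i))
  ⊎-reflects (<ᵇ-reflects-< p n ×-reflects ≡ᵇ-reflects-≡ i 0 ×-reflects ≡ᵇ-reflects-≡ j p)
  ⊎-reflects (≤ᵇ-reflects-≤ p i ×-reflects <ᵇ-reflects-< (suc i) n
                                ×-reflects ≡ᵇ-reflects-≡ j (suc i))
  ⊎-reflects (<ᵇ-reflects-< p n ×-reflects ≡ᵇ-reflects-≡ i (n ∸ 1)
                                ×-reflects ≡ᵇ-reflects-≡ j (p ∸ 1))
  ⊎-reflects (≡ᵇ-reflects-≡ p n ×-reflects ≡ᵇ-reflects-≡ i 0 ×-reflects ≡ᵇ-reflects-≡ j (p ∸ 1))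

darc? : ∀ n p i j → Dec (DArc n p i j)
darc? n p i j = Dec.map (⇔-sym DArc⇔DArc-cases) (darcᵇ n p i j because darcᵇ-reflects n p i j)

containsD? : ∀ {n} (G : Digraph n) p → Dec (ContainsD G p)
containsD? {n} G p = spanningCopy? G (darc? n p)

≅-sym : ∀ {n} {A B : Digraph n} → A ≅ B → B ≅ A
≅-sym {B = B} (σ , A≡B) = flip σ , λ i j →
  sym (trans (A≡B (σ ⟨$⟩ˡ i) (σ ⟨$⟩ˡ j)) (cong₂ B (inverseʳ σ) (inverseʳ σ)))

spanningCopy-≅ : ∀ {n} {A B : Digraph n} {R} → A ≅ B → SpanningCopy A R → SpanningCopy B R
spanningCopy-≅ {A = A} (ρ , A≡B) (σ , arcs) = σ ∘ₚ ρ , λ i j r → trans (sym (A≡B _ _)) (arcs i j r)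

containsD-≅ : ∀ {n} {A B : Digraph n} {p} → A ≅ B → ContainsD A p → ContainsD B p
containsD-≅ {n} {A} {B} {p} = spanningCopy-≅ {A = A} {B} {DArc n p}

indicator : Bool → ℕ
indicator b = if b then 1 else 0

length-filterᵇ-tabulate : ∀ {n} {A : Set} (P : A → Bool) (f : Fin n → A) →
  length (filterᵇ P (tabulate f)) ≡ sum (indicator ∘ P ∘ f)
length-filterᵇ-tabulate {zero}  P f = refl
length-filterᵇ-tabulate {suc n} P f with P (f zero)
... | true  = cong suc (length-filterᵇ-tabulate P (f ∘ suc))
... | false = length-filterᵇ-tabulate P (f ∘ suc)

length-filterᵇ-permute : ∀ {n} (σ : Permutation′ n) (P Q : Fin n → Bool) →
  (∀ w → P w ≡ Q (σ ⟨$⟩ʳ w)) → length (filterᵇ P (allFin n)) ≡ length (filterᵇ Q (allFin n))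
length-filterᵇ-permute σ P Q P≡Q∘σ = begin
  length (filterᵇ P (allFin _))    ≡⟨ length-filterᵇ-tabulate P (λ w → w) ⟩
  sum (indicator ∘ P)              ≡⟨ sum-cong-≗ (cong indicator ∘ P≡Q∘σ) ⟩
  sum (indicator ∘ Q ∘ (σ ⟨$⟩ʳ_))  ≡⟨ sum-permute (indicator ∘ Q) σ ⟨
  sum (indicator ∘ Q)              ≡⟨ length-filterᵇ-tabulate Q (λ w → w) ⟨
  length (filterᵇ Q (allFin _))    ∎
  where open ≡-Reasoning

regular-≅ : ∀ {n k} {A B : Digraph n} → A ≅ B → Regular k B → Regular k A
regular-≅ {A = A} {B} (σ , A≡B) regular v =
  trans (length-filterᵇ-permute σ (A v) (B (σ ⟨$⟩ʳ v)) (A≡B v))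
        (proj₁ (regular (σ ⟨$⟩ʳ v))) ,
  trans (length-filterᵇ-permute σ (λ w → A w v) (λ w → B w (σ ⟨$⟩ʳ v)) (λ w → A≡B w v))
        (proj₂ (regular (σ ⟨$⟩ʳ v)))

bipartiteTournament-pull : ∀ {m n} {G : Digraph n} (f : Fin m → Fin n) →
  BipartiteTournament G → BipartiteTournament (pull f G)
bipartiteTournament-pull f (side , inside , oneWay) =
  side ∘ f , (λ i j → inside (f i) (f j)) , (λ i j → oneWay (f i) (f j))

xor-≢ : ∀ {x y} → x ≢ y → x xor y ≡ true
xor-≢ {false} {false} x≢y = contradiction refl x≢y
xor-≢ {false} {true}  _   = refl
xor-≢ {true}  {false} _   = refl
xor-≢ {true}  {true}  x≢y = contradiction refl x≢y

xor≡true⇒≡not : ∀ {x y} → x xor y ≡ true → y ≡ not x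
xor≡true⇒≡not {false}         refl = refl
xor≡true⇒≡not {true}  {false} refl = refl

module Bipartite {n} {G : Digraph n} (bt : BipartiteTournament G) where

  side : Fin n → Bool
  side = proj₁ bt

  arc⇒sides-differ : ∀ {i j} → G i j ≡ true → side i ≢ side j
  arc⇒sides-differ {i} {j} arc same = contradiction (trans (sym arc) (proj₁ (proj₂ bt) i j same)) λ ()

  arc-sides : ∀ i j → G i j ≡ (side i xor side j) ∧ G i j
  arc-sides i j with side i ≟ᵇ side j
  ... | yes same   rewrite proj₁ (proj₂ bt) i j same = sym (∧-zeroʳ _)
  ... | no  differ rewrite xor-≢ differ = refl

  arc-converse : ∀ i j → G j i ≡ (side i xor side j) ∧ not (G i j)
  arc-converse i j with side i ≟ᵇ side j
  ... | yes same   rewrite same | xor-same (side j) = proj₁ (proj₂ bt) j i (sym same)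
  ... | no  differ rewrite xor-≢ differ = xor≡true⇒≡not (proj₂ (proj₂ bt) i j differ)

alternate : Bool → Fin 4 → Bool
alternate s 0F = s
alternate s 1F = not s
alternate s 2F = s
alternate s 3F = not s

C4-colouring : (c : Fin 4 → Bool) → (∀ {a b} → C4 a b ≡ true → c a ≢ c b) →
               ∀ a → c a ≡ alternate (c 0F) a
C4-colouring c proper = λ { 0F → refl ; 1F → c₁ ; 2F → c₂ ; 3F → c₃ }
  where
  next : ∀ {a b} → C4 a b ≡ true → c b ≡ not (c a)
  next arc = ¬-not (proper arc ∘ sym)
  c₁ : c 1F ≡ not (c 0F)
  c₁ = next {0F} {1F} refl
  c₂ : c 2F ≡ c 0F
  c₂ = trans (next {1F} {2F} refl) (trans (cong not c₁) (not-involutive _))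
  c₃ : c 3F ≡ not (c 0F)
  c₃ = trans (next {2F} {3F} refl) (cong not c₂)

TwoCycles : Digraph 8 → Set
TwoCycles H = (∀ a b → H (a ↑ˡ 4) (b ↑ˡ 4) ≡ C4 a b) × (∀ a b → H (4 ↑ʳ a) (4 ↑ʳ b) ≡ C4 a b)

decomposable⇒twoCycles : ∀ {G} → Decomposable 2 G → Σ[ τ ∈ Permutation′ 8 ] TwoCycles (pull (τ ⟨$⟩ʳ_) G)
decomposable⇒twoCycles {G} (_ , h , left , right) = τ , leftCycle , rightCycle
  where
  τ : Permutation′ 8
  τ = h ↔-∘ ((flip (proj₁ left) ⊎-↔ flip (proj₁ right)) ↔-∘ +↔⊎)
  leftCycle : ∀ a b → G (τ ⟨$⟩ʳ (a ↑ˡ 4)) (τ ⟨$⟩ʳ (b ↑ˡ 4)) ≡ C4 a b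
  leftCycle a b rewrite splitAt-↑ˡ 4 a 4 | splitAt-↑ˡ 4 b 4 =
    sym (proj₂ (≅-sym {A = pull (λ i → Inverse.to h (inj₁ i)) G} {C4} left) a b)
  rightCycle : ∀ a b → G (τ ⟨$⟩ʳ (4 ↑ʳ a)) (τ ⟨$⟩ʳ (4 ↑ʳ b)) ≡ C4 a b
  rightCycle a b = sym (proj₂ (≅-sym {A = pull (λ i → Inverse.to h (inj₂ i)) G} {C4} right) a b)

half : Fin 4 → Fin 2
half 0F = 0F
half 1F = 0F
half 2F = 1F
half 3F = 1F

-- Vertex a of the first cycle lies on side `alternate s a`, vertex b of the second on side
-- `alternate t b`.  An arc joins them iff these sides differ, and it leaves the first
-- cycle iff the bit of d at (a , half b) is set: the two vertices b on the side opposite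
-- to a have different halves.
canonical⊎ : Bool → Bool → Vec Bool 8 → Fin 4 ⊎ Fin 4 → Fin 4 ⊎ Fin 4 → Bool
canonical⊎ s t d (inj₁ a) (inj₁ b) = C4 a b
canonical⊎ s t d (inj₂ a) (inj₂ b) = C4 a b
canonical⊎ s t d (inj₁ a) (inj₂ b) = (alternate s a xor alternate t b) ∧ lookup d (combine a (half b))
canonical⊎ s t d (inj₂ b) (inj₁ a) = (alternate s a xor alternate t b) ∧ not (lookup d (combine a (half b)))

canonical : Bool → Bool → Vec Bool 8 → Digraph 8
canonical s t d i j = canonical⊎ s t d (splitAt 4 i) (splitAt 4 j)

guarded-∨ : ∀ {c x y} → x ≡ c ∧ x → y ≡ not c ∧ y → x ≡ c ∧ (x ∨ y) × y ≡ not c ∧ (x ∨ y)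
guarded-∨ {true}  {x} refl y≡false rewrite y≡false = sym (∨-identityʳ x) , refl
guarded-∨ {false} x≡false refl     rewrite x≡false = refl , refl

∧-not-∧ : ∀ c z → c ∧ not (c ∧ z) ≡ c ∧ not z
∧-not-∧ false z = refl
∧-not-∧ true  z = refl

-- Of the two vertices of half k of the second cycle, at most one is joined to a.
crossArc : Digraph 8 → Fin 4 → Fin 2 → Bool
crossArc H a k = H (a ↑ˡ 4) (4 ↑ʳ combine {n = 2} k 0F) ∨ H (a ↑ˡ 4) (4 ↑ʳ combine {n = 2} k 1F)

crossBits : Digraph 8 → Vec Bool 8
crossBits H = Vec.tabulate (uncurry (crossArc H) ∘ remQuot 2)

module CanonicalForm (H : Digraph 8) (bt : BipartiteTournament H) (cycles : TwoCycles H) where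

  open Bipartite bt

  s t : Bool
  s = side 0F
  t = side 4F

  across : Fin 4 → Fin 4 → Bool
  across a b = alternate s a xor alternate t b

  across-sides : ∀ a b → side (a ↑ˡ 4) xor side (4 ↑ʳ b) ≡ across a b
  across-sides a b = cong₂ _xor_
    (C4-colouring (side ∘ (_↑ˡ 4)) (arc⇒sides-differ ∘ trans (proj₁ cycles _ _)) a)
    (C4-colouring (side ∘ (4 ↑ʳ_)) (arc⇒sides-differ ∘ trans (proj₂ cycles _ _)) b)

  cross : Fin 4 → Fin 4 → Bool
  cross a b = H (a ↑ˡ 4) (4 ↑ʳ b)

  cross-sides : ∀ a b → cross a b ≡ across a b ∧ cross a b
  cross-sides a b = trans (arc-sides (a ↑ˡ 4) (4 ↑ʳ b)) (cong (_∧ cross a b) (across-sides a b))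

  cross-pair : ∀ a e o → alternate t o ≡ not (alternate t e) →
    cross a e ≡ across a e ∧ (cross a e ∨ cross a o) × cross a o ≡ across a o ∧ (cross a e ∨ cross a o)
  cross-pair a e o opposite =
    proj₁ guarded , subst (λ c → cross a o ≡ c ∧ (cross a e ∨ cross a o)) (sym flipped) (proj₂ guarded)
    where
    flipped : across a o ≡ not (across a e)
    flipped = trans (cong (alternate s a xor_) opposite)
                    (sym (not-distribʳ-xor (alternate s a) (alternate t e)))
    guarded = guarded-∨ (cross-sides a e)
                        (subst (λ c → cross a o ≡ c ∧ cross a o) flipped (cross-sides a o))

  lookup-crossBits : ∀ a k → lookup (crossBits H) (combine a k) ≡ crossArc H a k
  lookup-crossBits a k = trans (lookup∘tabulate (uncurry (crossArc H) ∘ remQuot 2) (combine a k))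
                               (cong (uncurry (crossArc H)) (remQuot-combine a k))

  cross-form : ∀ a b → cross a b ≡ across a b ∧ lookup (crossBits H) (combine a (half b))
  cross-form a b = trans (cross-half b) (cong (across a b ∧_) (sym (lookup-crossBits a (half b))))
    where
    cross-half : ∀ b → cross a b ≡ across a b ∧ crossArc H a (half b)
    cross-half 0F = proj₁ (cross-pair a 0F 1F refl)
    cross-half 1F = proj₂ (cross-pair a 0F 1F refl)
    cross-half 2F = proj₁ (cross-pair a 2F 3F refl)
    cross-half 3F = proj₂ (cross-pair a 2F 3F refl)

  canonical⊎-form : ∀ x y → H (join 4 4 x) (join 4 4 y) ≡ canonical⊎ s t (crossBits H) x y
  canonical⊎-form (inj₁ a) (inj₁ b) = proj₁ cycles a b
  canonical⊎-form (inj₂ a) (inj₂ b) = proj₂ cycles a b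
  canonical⊎-form (inj₁ a) (inj₂ b) = cross-form a b
  canonical⊎-form (inj₂ b) (inj₁ a) = begin
    H (4 ↑ʳ b) (a ↑ˡ 4)                                  ≡⟨ arc-converse (a ↑ˡ 4) (4 ↑ʳ b) ⟩
    (side (a ↑ˡ 4) xor side (4 ↑ʳ b)) ∧ not (cross a b)  ≡⟨ cong₂ (λ c x → c ∧ not x)
                                                                   (across-sides a b) (cross-form a b) ⟩
    across a b ∧ not (across a b ∧ bit)                  ≡⟨ ∧-not-∧ (across a b) bit ⟩
    across a b ∧ not bit                                 ∎
    where
    open ≡-Reasoning
    bit = lookup (crossBits H) (combine a (half b))

  canonical-form : ∀ i j → H i j ≡ canonical s t (crossBits H) i j
  canonical-form i j = begin
    H i j                                                ≡⟨ cong₂ H (join-splitAt 4 4 i) (join-splitAt 4 4 j) ⟨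
    H (join 4 4 (splitAt 4 i)) (join 4 4 (splitAt 4 j))  ≡⟨ canonical⊎-form (splitAt 4 i) (splitAt 4 j) ⟩
    canonical s t (crossBits H) i j                      ∎
    where open ≡-Reasoning

decomposable⇒canonical : ∀ {G} → Decomposable 2 G →
  Σ[ s ∈ Bool ] Σ[ t ∈ Bool ] Σ[ d ∈ Vec Bool 8 ] canonical s t d ≅ G
decomposable⇒canonical {G} dec@((bt , _) , _) with decomposable⇒twoCycles dec
... | τ , cycles = _ , _ , _ , τ , λ i j → sym (canonical-form i j)
  where open CanonicalForm (pull (τ ⟨$⟩ʳ_) G) (bipartiteTournament-pull (τ ⟨$⟩ʳ_) bt) cycles

OtherLengths : (ℕ → Set) → Set
OtherLengths P = ∀ p → 2 ≤ p → p ≤ 8 → p ≢ 5 → P p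

Dichotomy : Digraph 8 → Set
Dichotomy G = (ContainsD G 5 × OtherLengths (λ p → ¬ ContainsD G p)) ⊎ OtherLengths (ContainsD G)

dichotomy-≅ : ∀ {A B : Digraph 8} → A ≅ B → Dichotomy A → Dichotomy B
dichotomy-≅ {A} {B} A≅B (inj₁ (five , others)) = inj₁ (containsD-≅ {A = A} {B} A≅B five ,
  λ p 2≤p p≤8 p≢5 → others p 2≤p p≤8 p≢5 ∘ containsD-≅ {A = B} {A} (≅-sym {A = A} {B} A≅B))
dichotomy-≅ {A} {B} A≅B (inj₂ all) =
  inj₂ λ p 2≤p p≤8 p≢5 → containsD-≅ {A = A} {B} A≅B (all p 2≤p p≤8 p≢5)

otherLengths? : ∀ {P : ℕ → Set} → (∀ p → Dec (P p)) → Dec (OtherLengths P)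
otherLengths? P? = map′
  (λ all p 2≤p p≤8 → all (s≤s p≤8) 2≤p)
  (λ all {p} p<9 2≤p → all p 2≤p (≤-pred p<9))
  (allUpTo? (λ p → 2 ≤? p →-dec ¬? (p ≟ 5) →-dec P? p) 9)

dichotomy? : ∀ G → Dec (Dichotomy G)
dichotomy? G = (containsD? G 5 ×-dec otherLengths? (λ p → ¬? (containsD? G p)))
         ⊎-dec otherLengths? (containsD? G)

regular? : ∀ {n} k (G : Digraph n) → Dec (Regular k G)
regular? k G = all? λ v → outdeg G v ≟ k ×-dec indeg G v ≟ k

∀-Bool? : ∀ {P : Bool → Set} → (∀ b → Dec (P b)) → Dec (∀ b → P b)
∀-Bool? P? = map′ (λ (t , f) → λ { true → t ; false → f }) (λ all → all true , all false)
  (P? true ×-dec P? false)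

∀-Vec? : ∀ {n} {P : Vec Bool n → Set} → (∀ v → Dec (P v)) → Dec (∀ v → P v)
∀-Vec? {zero}  P? = map′ (λ p → λ { [] → p }) (λ all → all []) (P? [])
∀-Vec? {suc n} P? = map′ (λ all → λ { (b ∷ v) → all b v }) (λ all b v → all (b ∷ v))
  (∀-Bool? λ b → ∀-Vec? λ v → P? (b ∷ v))

-- For a large a?, checking `refl : does a? ≡ true` is much faster than `tt : True a?`.
by-evaluation : ∀ {A : Set} (a? : Dec A) → does a? ≡ true → A
by-evaluation {A} a? does≡true = invert (subst (Reflects A) does≡true (proof a?))

canonical-dichotomy : ∀ s t d → Regular 2 (canonical s t d) → Dichotomy (canonical s t d)
canonical-dichotomy = by-evaluation
  (∀-Bool? λ s → ∀-Bool? λ t → ∀-Vec? λ d →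
    regular? 2 (canonical s t d) →-dec dichotomy? (canonical s t d))
  refl

lemma2p1 : (G : Digraph 8) → Decomposable 2 G →
    (ContainsD G 5 × (∀ (p : ℕ) → 2 ≤ p → p ≤ 8 → p ≢ 5 → ¬ ContainsD G p))
    ⊎ (∀ (p : ℕ) → 2 ≤ p → p ≤ 8 → p ≢ 5 → ContainsD G p)
lemma2p1 G dec with decomposable⇒canonical dec
... | s , t , d , K≅G = dichotomy-≅ {canonical s t d} {G} K≅G
  (canonical-dichotomy s t d (regular-≅ {A = canonical s t d} {G} K≅G (proj₂ (proj₁ dec))))
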